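{- Let $\mathfrak a\subseteq S=k[x_1,\dots,x_n]$ be a monomial ideal, $A=S/\mathfrak a$, and $K^A_\bullet$ the Koszul complex of $A$ with respect to $x_1,\dots,x_n$. Let $c=\sum_I\alpha_I\frac{m}{x_I}e_I$ ($\alpha_I\in k$) be a homogeneous cycle of multidegree $m$, and fix a variable $x_0$ dividing $m$. Then there exists a cycle $c'=\sum_{I'}\alpha_{I'}\frac{m}{x_{I'}}e_{I'}$ homologous to $c$ such that $x_0\mid x_{I'}$ for all $I'$ occurring in $c'$.
   Context: $K_i^A$ is the free $A$-module with basis $e_I$, $I=\{j_1<\dots<j_i\}\subseteq[n]$, with differential $\partial e_I=\sum_{l=1}^i(-1)^{l+1}x_{j_l}e_{I\setminus\{j_l\}}$; $x_I=\prod_{j\in I}x_j$; $K^A$ is multigraded with $e_I$ of multidegree $x_I$. -}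

module Defs where

open import Level using (Level; _⊔_; Lift)
open import Data.Unit using (⊤)
open import Data.Nat as ℕ using (ℕ; zero; suc; _∸_; _≤_)
open import Data.Bool using (Bool; true; false; if_then_else_; _∧_)
open import Data.Fin using (Fin; zero; suc; _<?_)
open import Data.Fin.Subset using (Subset; _∈_; _∉_; _∪_; ⁅_⁆; ∣_∣)
open import Data.Vec using (lookup)
open import Data.Product using (_×_; Σ)
open import Relation.Nullary using (¬_; does)
open import Relation.Binary.PropositionalEquality using (_≡_)
open import Algebra.Bundles using (CommutativeRing)

record Field (c ℓ : Level) : Set (Level.suc (c ⊔ ℓ)) where
  field
    commutativeRing : CommutativeRing c ℓ
  open CommutativeRing commutativeRing public
  field
    1≉0     : ¬ (1# ≈ 0#)
    inverse : ∀ x → ¬ (x ≈ 0#) → Σ Carrier λ y → x * y ≈ 1#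

Monomial : ℕ → Set
Monomial n = Fin n → ℕ

_∣ᵐ_ : ∀ {n} → Monomial n → Monomial n → Set
u ∣ᵐ v = ∀ j → u j ≤ v j

-- A monomial ideal 𝔞 ⊆ S, described (as usual) by the set of monomials
-- it contains, which is closed under multiplication by monomials.
record MonomialIdeal (n : ℕ) : Set₁ where
  field
    _∈𝔞     : Monomial n → Set
    closed : ∀ {u v} → u ∣ᵐ v → u ∈𝔞 → v ∈𝔞
open MonomialIdeal public

x[_] : ∀ {n} → Subset n → Monomial n
x[ I ] j = if lookup I j then 1 else 0

var : ∀ {n} → Fin n → Monomial n
var j = x[ ⁅ j ⁆ ]

-- m / u (exponentwise truncated subtraction; exact when u ∣ m)
_/ᵐ_ : ∀ {n} → Monomial n → Monomial n → Monomial n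
(m /ᵐ u) j = m j ∸ u j

-- (K^A_i)_m has k-basis the elements (m/x_I) e_I with |I| = i, x_I ∣ m
-- and m/x_I ∉ 𝔞 (the others are 0 in A).  A homogeneous element of
-- multidegree m and homological degree i is written, as in the paper,
-- Σ_I α_I (m/x_I) e_I, i.e. by a coefficient family α : Subset n → k;
-- only coefficients at "basis" indices I matter.

module Koszul {c ℓ} (k : Field c ℓ) {n : ℕ} (𝔞 : MonomialIdeal n) (m : Monomial n) where
  open Field k using (Carrier; _≈_; _+_; _*_; -_; 0#; 1#)

  Chain : Set c
  Chain = Subset n → Carrier

  Basis : ℕ → Subset n → Set
  Basis i I = ∣ I ∣ ≡ i × x[ I ] ∣ᵐ m × ¬ ((𝔞 ∈𝔞) (m /ᵐ x[ I ]))

  _≈[_]_ : Chain → ℕ → Chain → Set ℓ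
  α ≈[ i ] β = ∀ I → Basis i I → α I ≈ β I

  sumFin : ∀ {p} → (Fin p → Carrier) → Carrier
  sumFin {zero}  f = 0#
  sumFin {suc p} f = f zero + sumFin (λ j → f (suc j))

  negPow : ℕ → Carrier
  negPow zero    = 1#
  negPow (suc e) = - negPow e

  below : Subset n → Fin n → ℕ
  below J j = countFin (λ j' → lookup J j' ∧ does (j' <? j))
    where
    countFin : ∀ {p} → (Fin p → Bool) → ℕ
    countFin {zero}  f = 0
    countFin {suc p} f = (if f zero then 1 else 0) ℕ.+ countFin (λ j' → f (suc j'))

  -- Koszul differential on multidegree-m chains:
  --   ∂ (m/x_I) e_I = Σ_l (-1)^{l+1} x_{j_l} (m/x_I) e_{I∖j_l}
  --                 = Σ_l (-1)^{l+1} (m/x_{I∖j_l}) e_{I∖j_l},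
  -- so the coefficient of (m/x_J) e_J in ∂(Σ α_I (m/x_I) e_I) is
  --   Σ_{j ∉ J, x_j ∣ m} (-1)^{#{j'∈J : j'<j}} α_{J ∪ {j}}.
  ∂ : Chain → Chain
  ∂ α J = sumFin λ j →
    if lookup J j then 0#
    else (if does (1 ℕ.≤? m j) then negPow (below J j) * α (J ∪ ⁅ j ⁆) else 0#)

  -- α (in homological degree i) is a cycle: ∂α = 0 in K_{i-1}^A
  -- (K_0^A has zero differential, so every element of degree 0 is a cycle)
  IsCycle : ℕ → Chain → Set ℓ
  IsCycle zero    α = Lift ℓ ⊤
  IsCycle (suc i) α = ∂ α ≈[ i ] (λ _ → 0#)

  Homologous : ℕ → Chain → Chain → Set (c ⊔ ℓ)
  Homologous i α α' = Σ Chain λ β → (λ I → α I + (- α' I)) ≈[ i ] ∂ β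

-- Put β = e_{x₀} ∧ α and α' = α − ∂β. Since x₀ ∣ m, the differential has a
-- face removing x₀, and for I ∌ x₀ the only term of (∂β)_I is the one adding
-- x₀ back to I, which returns α_I; so α' vanishes on all I ∌ x₀. α' is
-- homologous to α by construction, and a cycle because ∂∂ = 0 already holds
-- coefficientwise, on all subsets: the two ways of adding x and y to J carry
-- opposite signs. The basis conditions enter only through the hypothesis on α.

module Submission where

open import Defs
open import Data.Nat using (ℕ; zero; suc; _≤_; _≤?_)
open import Data.Bool using (Bool; true; false; if_then_else_; not; _∧_; _∨_)
open import Data.Bool.Properties using (∧-identityʳ; ∧-zeroʳ; ∨-zeroʳ; ∨-identityʳ; ¬-not)
open import Data.Fin using (Fin; zero; suc; punchIn; _<_; _<?_)
open import Data.Fin.Properties using (suc-injective; punchInᵢ≢i; <-cmp; <-asym; <-irrefl)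
open import Data.Fin.Subset using (Subset; ⊥; ⁅_⁆; _∪_; _-_; _∉_)
open import Data.Fin.Subset.Properties using (∪-identityʳ; ∪-assoc; ∪-comm; p─⊥≡p; x∈⁅x⁆; x≢y⇒x∉⁅y⁆)
open import Data.Vec using ([]; _∷_; lookup)
open import Data.Vec.Properties using (lookup-zipWith; []=⇒lookup; lookup⇒[]=)
open import Data.Product using (Σ; _×_; _,_)
open import Data.Unit using (⊤; tt)
open import Data.Empty using (⊥-elim)
open import Level using (lift)
open import Function using (_∘_)
open import Algebra.Bundles using (AbelianGroup; Ring)
open import Relation.Nullary using (¬_; does)
open import Relation.Nullary.Decidable using (dec-true; dec-false)
open import Relation.Binary.Definitions using (tri<; tri≈; tri>)
open import Relation.Binary.PropositionalEquality as ≡ using (_≡_; _≢_; cong; cong₂; subst)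

module AbelianGroupSum {a ℓ} (G : AbelianGroup a ℓ) where
  open AbelianGroup G renaming
    ( _∙_ to _+_; ε to 0#; _⁻¹ to -_; ∙-cong to +-cong; ∙-congˡ to +-congˡ; ∙-congʳ to +-congʳ
    ; identityˡ to +-identityˡ; identityʳ to +-identityʳ; inverseʳ to -‿inverseʳ )
  open import Algebra.Properties.AbelianGroup G using (ε⁻¹≈ε; ⁻¹-∙-comm)
  open import Algebra.Properties.CommutativeMonoid.Sum commutativeMonoid public
    using (sum; sum-syntax; sum-cong-≋; sum-cong-≗; ∑-distrib-+; sum-remove; sum-replicate-zero)
  open import Relation.Binary.Reasoning.Setoid setoid

  ∑-neg : ∀ {p} (f : Fin p → Carrier) → ∑[ i < p ] (- f i) ≈ - sum f
  ∑-neg {zero}  f = sym ε⁻¹≈ε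
  ∑-neg {suc p} f = trans (+-congˡ (∑-neg (f ∘ suc))) (⁻¹-∙-comm (f zero) (sum (f ∘ suc)))

  ∑-single : ∀ {p} (f : Fin p → Carrier) i → (∀ j → j ≢ i → f j ≈ 0#) → sum f ≈ f i
  ∑-single {suc p} f i f≈0 = begin
    sum f                             ≈⟨ sum-remove {i = i} f ⟩
    f i + ∑[ j < p ] f (punchIn i j)  ≈⟨ +-congˡ (sum-cong-≋ {p} (λ j → f≈0 _ (punchInᵢ≢i i j))) ⟩
    f i + ∑[ j < p ] 0#               ≈⟨ +-congˡ (sum-replicate-zero p) ⟩
    f i + 0#                          ≈⟨ +-identityʳ (f i) ⟩
    f i                               ∎

  -- Antisymmetry alone would only give 2·Σ ≈ 0.
  ∑∑-antisymmetric≈0 : ∀ {p} (T : Fin p → Fin p → Carrier) →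
                       (∀ i j → i ≢ j → T i j ≈ - T j i) → (∀ i → T i i ≈ 0#) →
                       ∑[ i < p ] ∑[ j < p ] T i j ≈ 0#
  ∑∑-antisymmetric≈0 {zero}  T anti diag = refl
  ∑∑-antisymmetric≈0 {suc p} T anti diag = begin
    (T zero zero + first-row) + ∑[ i < p ] (T (suc i) zero + ∑[ j < p ] T (suc i) (suc j))
      ≈⟨ +-cong (+-congʳ (diag zero)) (∑-distrib-+ (λ i → T (suc i) zero) _) ⟩
    (0# + first-row) + (∑[ i < p ] T (suc i) zero + ∑[ i < p ] ∑[ j < p ] T (suc i) (suc j))
      ≈⟨ +-cong (+-identityˡ first-row) (+-cong first-column minor) ⟩
    first-row + (- first-row + 0#)
      ≈⟨ +-congˡ (+-identityʳ (- first-row)) ⟩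
    first-row + - first-row
      ≈⟨ -‿inverseʳ first-row ⟩
    0# ∎
    where
    first-row = ∑[ j < p ] T zero (suc j)

    first-column : ∑[ i < p ] T (suc i) zero ≈ - first-row
    first-column = trans (sum-cong-≋ {p} (λ i → anti (suc i) zero λ ())) (∑-neg (T zero ∘ suc))

    minor : ∑[ i < p ] ∑[ j < p ] T (suc i) (suc j) ≈ 0#
    minor = ∑∑-antisymmetric≈0 (λ i j → T (suc i) (suc j))
              (λ i j i≢j → anti (suc i) (suc j) (i≢j ∘ suc-injective)) (diag ∘ suc)

module Guarded {c ℓ} (R : Ring c ℓ) where
  open Ring R hiding (_-_)
  open import Algebra.Properties.Ring R using (-‿distribʳ-*; -0#≈0#)
  open import Algebra.Properties.Semiring.Sum semiring using (sum; sum-syntax; sum-replicate-zero; *-distribˡ-sum)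

  when : Bool → Carrier → Carrier
  when b x = if b then x else 0#

  when-⊖ : ∀ b s x y → when b (s * (x + - y)) ≈ when b (s * x) + - when b (s * y)
  when-⊖ true  s x y = trans (distribˡ s x (- y)) (+-congˡ (sym (-‿distribʳ-* s y)))
  when-⊖ false s x y = sym (trans (+-congˡ -0#≈0#) (+-identityʳ 0#))

  when-*-∑ : ∀ {p} b x (f : Fin p → Carrier) → when b (x * sum f) ≈ ∑[ j < p ] when b (x * f j)
  when-*-∑ true  x f = *-distribˡ-sum x f
  when-*-∑ {p} false x f = sym (sum-replicate-zero p)

  when-*-when : ∀ b b′ x y z → when b (x * when b′ (y * z)) ≈ when (b ∧ b′) (x * y * z)
  when-*-when true  true  x y z = sym (*-assoc x y z)
  when-*-when true  false x y z = zeroʳ x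
  when-*-when false b′    x y z = refl

  when-∧-antisym : ∀ b b′ {x y} → (b ≡ true → b′ ≡ true → x ≈ - y) → when (b ∧ b′) x ≈ - when (b′ ∧ b) y
  when-∧-antisym true  true  x≈-y = x≈-y ≡.refl ≡.refl
  when-∧-antisym true  false _    = sym -0#≈0#
  when-∧-antisym false true  _    = sym -0#≈0#
  when-∧-antisym false false _    = sym -0#≈0#

∉⇒lookup≡false : ∀ {n} {p : Subset n} {x} → x ∉ p → lookup p x ≡ false
∉⇒lookup≡false {p = p} {x} x∉p = ¬-not (x∉p ∘ lookup⇒[]= x p)

lookup-∪⁅x⁆-x : ∀ {n} (p : Subset n) x → lookup (p ∪ ⁅ x ⁆) x ≡ true
lookup-∪⁅x⁆-x (b ∷ p) zero    = ∨-zeroʳ b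
lookup-∪⁅x⁆-x (b ∷ p) (suc x) = lookup-∪⁅x⁆-x p x

lookup-∪⁅x⁆-y : ∀ {n} (p : Subset n) {x y} → y ≢ x → lookup (p ∪ ⁅ x ⁆) y ≡ lookup p y
lookup-∪⁅x⁆-y p {x} {y} y≢x = begin
  lookup (p ∪ ⁅ x ⁆) y         ≡⟨ lookup-zipWith _∨_ y p ⁅ x ⁆ ⟩
  lookup p y ∨ lookup ⁅ x ⁆ y  ≡⟨ cong (lookup p y ∨_) (∉⇒lookup≡false (x≢y⇒x∉⁅y⁆ y≢x)) ⟩
  lookup p y ∨ false           ≡⟨ ∨-identityʳ (lookup p y) ⟩
  lookup p y                   ∎
  where open ≡.≡-Reasoning

p∪⁅x⁆∪⁅y⁆≡p∪⁅y⁆∪⁅x⁆ : ∀ {n} (p : Subset n) x y → (p ∪ ⁅ x ⁆) ∪ ⁅ y ⁆ ≡ (p ∪ ⁅ y ⁆) ∪ ⁅ x ⁆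
p∪⁅x⁆∪⁅y⁆≡p∪⁅y⁆∪⁅x⁆ p x y = begin
  (p ∪ ⁅ x ⁆) ∪ ⁅ y ⁆  ≡⟨ ∪-assoc p ⁅ x ⁆ ⁅ y ⁆ ⟩
  p ∪ (⁅ x ⁆ ∪ ⁅ y ⁆)  ≡⟨ cong (p ∪_) (∪-comm ⁅ x ⁆ ⁅ y ⁆) ⟩
  p ∪ (⁅ y ⁆ ∪ ⁅ x ⁆)  ≡⟨ ∪-assoc p ⁅ y ⁆ ⁅ x ⁆ ⟨
  (p ∪ ⁅ y ⁆) ∪ ⁅ x ⁆  ∎
  where open ≡.≡-Reasoning

p∪⁅x⁆-x≡p : ∀ {n} (p : Subset n) x → lookup p x ≡ false → (p ∪ ⁅ x ⁆) - x ≡ p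
p∪⁅x⁆-x≡p (false ∷ p) zero    ≡.refl = cong (false ∷_) (≡.trans (p─⊥≡p (p ∪ ⊥)) (∪-identityʳ p))
p∪⁅x⁆-x≡p (b ∷ p)     (suc x) x∉p  = cong₂ _∷_ (∨-identityʳ b) (p∪⁅x⁆-x≡p p x x∉p)

-- Not Data.Bool.toℕ: this is the form of the indicators in Defs, so it agrees
-- with them definitionally.
[_] : Bool → ℕ
[ b ] = if b then 1 else 0

var-∣ᵐ⇒1≤ : ∀ {n} {x : Fin n} {m : Monomial n} → var x ∣ᵐ m → 1 ≤ m x
var-∣ᵐ⇒1≤ {x = x} {m} x∣m = subst (λ b → [ b ] ≤ m x) ([]=⇒lookup (x∈⁅x⁆ x)) (x∣m x)

module Below {c ℓ} (k : Field c ℓ) where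
  open import Data.Nat using (_+_)
  open import Data.Nat.Properties using (+-suc)

  [b]+[c]+n≡[c]+[b]+n : ∀ b c n → [ b ] + ([ c ] + n) ≡ [ c ] + ([ b ] + n)
  [b]+[c]+n≡[c]+[b]+n false c n = ≡.refl
  [b]+[c]+n≡[c]+[b]+n true  c n = ≡.sym (+-suc [ c ] n)

  unitIdeal : ∀ n → MonomialIdeal n
  unitIdeal n = record { _∈𝔞 = λ _ → ⊤ ; closed = λ _ _ → tt }

  -- Koszul.below depends on neither the ideal nor the multidegree (its
  -- instances are definitionally equal), so its combinatorics is done once,
  -- for the unit ideal, in every number of variables.
  below : ∀ {n} → Subset n → Fin n → ℕ
  below {n} = Koszul.below k (unitIdeal n) (λ _ → 0)

  below-∷-zero : ∀ {n} b (p : Subset n) → below (b ∷ p) zero ≡ 0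
  below-∷-zero b []       rewrite ∧-zeroʳ b = ≡.refl
  below-∷-zero b (b′ ∷ p) rewrite ∧-zeroʳ b = below-∷-zero b′ p

  below-∷-suc : ∀ {n} b (p : Subset n) y → below (b ∷ p) (suc y) ≡ [ b ] + below p y
  below-∷-suc b p y rewrite ∧-identityʳ b = ≡.refl

  below-∪⁅x⁆ : ∀ {n} (p : Subset n) x y → lookup p x ≡ false →
               below (p ∪ ⁅ x ⁆) y ≡ [ does (x <? y) ] + below p y
  below-∪⁅x⁆ (b ∷ p) zero zero _ = ≡.trans (below-∷-zero (b ∨ true) (p ∪ ⊥)) (≡.sym (below-∷-zero b p))
  below-∪⁅x⁆ (false ∷ p) zero (suc y) ≡.refl = begin
    below (true ∷ (p ∪ ⊥)) (suc y)   ≡⟨ below-∷-suc true (p ∪ ⊥) y ⟩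
    suc (below (p ∪ ⊥) y)            ≡⟨ cong (λ q → suc (below q y)) (∪-identityʳ p) ⟩
    suc (below p y)                  ≡⟨ cong suc (below-∷-suc false p y) ⟨
    suc (below (false ∷ p) (suc y))  ∎
    where open ≡.≡-Reasoning
  below-∪⁅x⁆ (b ∷ p) (suc x) zero _ = ≡.trans (below-∷-zero (b ∨ false) (p ∪ ⁅ x ⁆)) (≡.sym (below-∷-zero b p))
  below-∪⁅x⁆ (b ∷ p) (suc x) (suc y) x∉p = begin
    below ((b ∨ false) ∷ (p ∪ ⁅ x ⁆)) (suc y)  ≡⟨ below-∷-suc (b ∨ false) (p ∪ ⁅ x ⁆) y ⟩
    [ b ∨ false ] + below (p ∪ ⁅ x ⁆) y        ≡⟨ cong₂ (λ b′ n → [ b′ ] + n) (∨-identityʳ b) (below-∪⁅x⁆ p x y x∉p) ⟩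
    [ b ] + ([ does (x <? y) ] + below p y)     ≡⟨ [b]+[c]+n≡[c]+[b]+n b (does (x <? y)) (below p y) ⟩
    [ does (x <? y) ] + ([ b ] + below p y)     ≡⟨ cong ([ does (x <? y) ] +_) (below-∷-suc b p y) ⟨
    [ does (x <? y) ] + below (b ∷ p) (suc y)   ∎
    where open ≡.≡-Reasoning

  below-∪⁅x⁆-< : ∀ {n} (p : Subset n) {x y} → lookup p x ≡ false → x < y → below (p ∪ ⁅ x ⁆) y ≡ suc (below p y)
  below-∪⁅x⁆-< p {x} {y} x∉p x<y =
    ≡.trans (below-∪⁅x⁆ p x y x∉p) (cong (λ b → [ b ] + below p y) (dec-true (x <? y) x<y))

  below-∪⁅x⁆-≮ : ∀ {n} (p : Subset n) {x y} → lookup p x ≡ false → ¬ x < y → below (p ∪ ⁅ x ⁆) y ≡ below p y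
  below-∪⁅x⁆-≮ p {x} {y} x∉p x≮y =
    ≡.trans (below-∪⁅x⁆ p x y x∉p) (cong (λ b → [ b ] + below p y) (dec-false (x <? y) x≮y))

module KoszulComplex {c ℓ} (k : Field c ℓ) {n : ℕ} (𝔞 : MonomialIdeal n) (m : Monomial n) where
  open Field k hiding (zero; _-_)
  open Koszul k 𝔞 m public
  open Below k using (below-∪⁅x⁆-<; below-∪⁅x⁆-≮)
  open AbelianGroupSum +-abelianGroup
  open import Algebra.Properties.AbelianGroup +-abelianGroup using (⁻¹-anti-homo‿-; xyx⁻¹≈y)
  open import Algebra.Properties.Ring ring using (-‿distribˡ-*; -‿distribʳ-*; -‿involutive)
  open Guarded ring
  open import Relation.Binary.Reasoning.Setoid setoid

  sgn : Subset n → Fin n → Carrier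
  sgn J j = negPow (below J j)

  addable : Subset n → Fin n → Bool
  addable J j = not (lookup J j) ∧ does (1 ≤? m j)

  sumFin≡sum : ∀ {p} (f : Fin p → Carrier) → sumFin f ≡ sum f
  sumFin≡sum {zero}  f = ≡.refl
  sumFin≡sum {suc p} f = cong (f zero +_) (sumFin≡sum (f ∘ suc))

  ∂-expand : ∀ α J → ∂ α J ≡ ∑[ j < n ] when (addable J j) (sgn J j * α (J ∪ ⁅ j ⁆))
  ∂-expand α J = ≡.trans (sumFin≡sum {n} _) (sum-cong-≗ {n} λ j → if-as-when (lookup J j) (does (1 ≤? m j)))
    where
    if-as-when : ∀ b c {x} → (if b then 0# else (if c then x else 0#)) ≡ when (not b ∧ c) x
    if-as-when true  c     = ≡.refl
    if-as-when false true  = ≡.refl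
    if-as-when false false = ≡.refl

  addable-∪⁅x⁆-x : ∀ J x → addable (J ∪ ⁅ x ⁆) x ≡ false
  addable-∪⁅x⁆-x J x = cong (λ b → not b ∧ does (1 ≤? m x)) (lookup-∪⁅x⁆-x J x)

  addable-∪⁅x⁆-y : ∀ J {x y} → y ≢ x → addable (J ∪ ⁅ x ⁆) y ≡ addable J y
  addable-∪⁅x⁆-y J {y = y} y≢x = cong (λ b → not b ∧ does (1 ≤? m y)) (lookup-∪⁅x⁆-y J y≢x)

  addable⇒∉ : ∀ J x → addable J x ≡ true → lookup J x ≡ false
  addable⇒∉ J x addable≡true with lookup J x | addable≡true
  ... | false | _ = ≡.refl

  ∉⇒addable : ∀ J x → lookup J x ≡ false → 1 ≤ m x → addable J x ≡ true
  ∉⇒addable J x x∉J 1≤mx = cong₂ (λ b c → not b ∧ c) x∉J (dec-true (1 ≤? m x) 1≤mx)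

  negPow-square : ∀ e → negPow e * negPow e ≈ 1#
  negPow-square zero    = *-identityˡ 1#
  negPow-square (suc e) = begin
    - negPow e * - negPow e    ≈⟨ -‿distribʳ-* (- negPow e) (negPow e) ⟨
    - (- negPow e * negPow e)  ≈⟨ -‿cong (-‿distribˡ-* (negPow e) (negPow e)) ⟨
    - - (negPow e * negPow e)  ≈⟨ -‿involutive (negPow e * negPow e) ⟩
    negPow e * negPow e        ≈⟨ negPow-square e ⟩
    1#                         ∎

  sgn-∪⁅x⁆-< : ∀ J {x y} → lookup J x ≡ false → x < y → sgn (J ∪ ⁅ x ⁆) y ≡ - sgn J y
  sgn-∪⁅x⁆-< J x∉J x<y = cong negPow (below-∪⁅x⁆-< J x∉J x<y)

  sgn-∪⁅x⁆-≮ : ∀ J {x y} → lookup J x ≡ false → ¬ x < y → sgn (J ∪ ⁅ x ⁆) y ≡ sgn J y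
  sgn-∪⁅x⁆-≮ J x∉J x≮y = cong negPow (below-∪⁅x⁆-≮ J x∉J x≮y)

  sgn₂ : Subset n → Fin n → Fin n → Carrier
  sgn₂ J x y = sgn J x * sgn (J ∪ ⁅ x ⁆) y

  sgn₂-antisym-< : ∀ J {x y} → lookup J x ≡ false → lookup J y ≡ false → x < y → sgn₂ J x y ≈ - sgn₂ J y x
  sgn₂-antisym-< J {x} {y} x∉J y∉J x<y = begin
    sgn J x * sgn (J ∪ ⁅ x ⁆) y    ≡⟨ cong (sgn J x *_) (sgn-∪⁅x⁆-< J x∉J x<y) ⟩
    sgn J x * - sgn J y            ≈⟨ -‿distribʳ-* (sgn J x) (sgn J y) ⟨
    - (sgn J x * sgn J y)          ≈⟨ -‿cong (*-comm (sgn J x) (sgn J y)) ⟩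
    - (sgn J y * sgn J x)          ≡⟨ cong (λ s → - (sgn J y * s)) (sgn-∪⁅x⁆-≮ J y∉J (<-asym x<y)) ⟨
    - (sgn J y * sgn (J ∪ ⁅ y ⁆) x) ∎

  sgn₂-antisym : ∀ J {x y} → lookup J x ≡ false → lookup J y ≡ false → x ≢ y → sgn₂ J x y ≈ - sgn₂ J y x
  sgn₂-antisym J {x} {y} x∉J y∉J x≢y with <-cmp x y
  ... | tri< x<y _   _   = sgn₂-antisym-< J x∉J y∉J x<y
  ... | tri≈ _   x≡y _   = ⊥-elim (x≢y x≡y)
  ... | tri> _   _   y<x = sym (trans (-‿cong (sgn₂-antisym-< J y∉J x∉J y<x)) (-‿involutive (sgn₂ J x y)))

  _⊖_ : Chain → Chain → Chain
  (α ⊖ β) I = α I + - β I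

  ∂-⊖ : ∀ α β J → ∂ (α ⊖ β) J ≈ (∂ α ⊖ ∂ β) J
  ∂-⊖ α β J = begin
    ∂ (α ⊖ β) J                                            ≡⟨ ∂-expand (α ⊖ β) J ⟩
    ∑[ j < n ] when (addable J j) (sgn J j * (α ⊖ β) (J ∪ ⁅ j ⁆))
      ≈⟨ sum-cong-≋ {n} (λ j → when-⊖ (addable J j) (sgn J j) (α (J ∪ ⁅ j ⁆)) (β (J ∪ ⁅ j ⁆))) ⟩
    ∑[ j < n ] (face α j + - face β j)                      ≈⟨ ∑-distrib-+ (face α) (λ j → - face β j) ⟩
    ∑[ j < n ] face α j + ∑[ j < n ] (- face β j)           ≈⟨ +-congˡ (∑-neg (face β)) ⟩
    ∑[ j < n ] face α j + - ∑[ j < n ] face β j             ≡⟨ cong₂ (λ a b → a + - b) (∂-expand α J) (∂-expand β J) ⟨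
    ∂ α J + - ∂ β J                                         ∎
    where
    face : Chain → Fin n → Carrier
    face γ j = when (addable J j) (sgn J j * γ (J ∪ ⁅ j ⁆))

  ∂∘∂≈0 : ∀ β J → ∂ (∂ β) J ≈ 0#
  ∂∘∂≈0 β J = begin
    ∂ (∂ β) J                                                  ≡⟨ ∂-expand (∂ β) J ⟩
    ∑[ j < n ] when (addable J j) (sgn J j * ∂ β (J ∪ ⁅ j ⁆))  ≈⟨ sum-cong-≋ {n} expand-inner ⟩
    ∑[ j < n ] ∑[ j′ < n ] T j j′                              ≈⟨ ∑∑-antisymmetric≈0 T T-antisym T-diagonal ⟩
    0#                                                         ∎
    where
    term : Fin n → Fin n → Carrier
    term j j′ = sgn₂ J j j′ * β ((J ∪ ⁅ j ⁆) ∪ ⁅ j′ ⁆)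

    T : Fin n → Fin n → Carrier
    T j j′ = when (addable J j ∧ addable (J ∪ ⁅ j ⁆) j′) (term j j′)

    expand-inner : ∀ j → when (addable J j) (sgn J j * ∂ β (J ∪ ⁅ j ⁆)) ≈ ∑[ j′ < n ] T j j′
    expand-inner j = begin
      when (addable J j) (sgn J j * ∂ β (J ∪ ⁅ j ⁆))
        ≡⟨ cong (λ x → when (addable J j) (sgn J j * x)) (∂-expand β (J ∪ ⁅ j ⁆)) ⟩
      when (addable J j) (sgn J j * ∑[ j′ < n ] inner j′)
        ≈⟨ when-*-∑ {n} (addable J j) (sgn J j) inner ⟩
      ∑[ j′ < n ] when (addable J j) (sgn J j * inner j′)
        ≈⟨ sum-cong-≋ {n} (λ j′ → when-*-when (addable J j) (addable (J ∪ ⁅ j ⁆) j′) _ _ _) ⟩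
      ∑[ j′ < n ] T j j′ ∎
      where
      inner : Fin n → Carrier
      inner j′ = when (addable (J ∪ ⁅ j ⁆) j′) (sgn (J ∪ ⁅ j ⁆) j′ * β ((J ∪ ⁅ j ⁆) ∪ ⁅ j′ ⁆))

    T-diagonal : ∀ j → T j j ≈ 0#
    T-diagonal j = reflexive (cong (λ b → when b (term j j)) (≡.trans (cong (addable J j ∧_) (addable-∪⁅x⁆-x J j)) (∧-zeroʳ _)))

    T-antisym : ∀ j j′ → j ≢ j′ → T j j′ ≈ - T j′ j
    T-antisym j j′ j≢j′ = begin
      T j j′
        ≡⟨ cong (λ b → when (addable J j ∧ b) (term j j′)) (addable-∪⁅x⁆-y J (j≢j′ ∘ ≡.sym)) ⟩
      when (addable J j ∧ addable J j′) (term j j′)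
        ≈⟨ when-∧-antisym (addable J j) (addable J j′) swap ⟩
      - when (addable J j′ ∧ addable J j) (term j′ j)
        ≡⟨ cong (λ b → - when (addable J j′ ∧ b) (term j′ j)) (addable-∪⁅x⁆-y J j≢j′) ⟨
      - T j′ j ∎
      where
      swap : addable J j ≡ true → addable J j′ ≡ true → term j j′ ≈ - term j′ j
      swap j-addable j′-addable = begin
        sgn₂ J j j′ * β ((J ∪ ⁅ j ⁆) ∪ ⁅ j′ ⁆)
          ≈⟨ *-congʳ (sgn₂-antisym J (addable⇒∉ J j j-addable) (addable⇒∉ J j′ j′-addable) j≢j′) ⟩
        - sgn₂ J j′ j * β ((J ∪ ⁅ j ⁆) ∪ ⁅ j′ ⁆)
          ≡⟨ cong (λ K → - sgn₂ J j′ j * β K) (p∪⁅x⁆∪⁅y⁆≡p∪⁅y⁆∪⁅x⁆ J j j′) ⟩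
        - sgn₂ J j′ j * β ((J ∪ ⁅ j′ ⁆) ∪ ⁅ j ⁆)
          ≈⟨ -‿distribˡ-* (sgn₂ J j′ j) _ ⟨
        - (sgn₂ J j′ j * β ((J ∪ ⁅ j′ ⁆) ∪ ⁅ j ⁆)) ∎

  -- e_x ∧ e_{K - x} = (−1)^(below K x) e_K for x ∈ K.
  e[_]∧_ : Fin n → Chain → Chain
  (e[ x ]∧ α) K = when (lookup K x) (sgn K x * α (K - x))

  ∂-e[x]∧-∉ : ∀ x α I → lookup I x ≡ false → 1 ≤ m x → ∂ (e[ x ]∧ α) I ≈ α I
  ∂-e[x]∧-∉ x α I x∉I 1≤mx = begin
    ∂ (e[ x ]∧ α) I                                              ≡⟨ ∂-expand (e[ x ]∧ α) I ⟩
    ∑[ j < n ] face j                                            ≈⟨ ∑-single face x face-vanishes ⟩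
    face x                                                       ≈⟨ when-*-when (addable I x) (lookup (I ∪ ⁅ x ⁆) x) _ _ _ ⟩
    when (addable I x ∧ lookup (I ∪ ⁅ x ⁆) x) (term x)           ≡⟨ cong (λ b → when b (term x)) guard-holds ⟩
    sgn I x * sgn (I ∪ ⁅ x ⁆) x * α ((I ∪ ⁅ x ⁆) - x)
      ≡⟨ cong₂ (λ s K → sgn I x * s * α K) (sgn-∪⁅x⁆-≮ I x∉I (<-irrefl ≡.refl)) (p∪⁅x⁆-x≡p I x x∉I) ⟩
    sgn I x * sgn I x * α I                                      ≈⟨ *-congʳ (negPow-square (below I x)) ⟩
    1# * α I                                                     ≈⟨ *-identityˡ (α I) ⟩
    α I                                                          ∎
    where
    face : Fin n → Carrier
    face j = when (addable I j) (sgn I j * (e[ x ]∧ α) (I ∪ ⁅ j ⁆))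

    term : Fin n → Carrier
    term j = sgn I j * sgn (I ∪ ⁅ j ⁆) x * α ((I ∪ ⁅ j ⁆) - x)

    face-vanishes : ∀ j → j ≢ x → face j ≈ 0#
    face-vanishes j j≢x = trans (when-*-when (addable I j) (lookup (I ∪ ⁅ j ⁆) x) _ _ _)
      (reflexive (cong (λ b → when b (term j))
        (≡.trans (cong (addable I j ∧_) (≡.trans (lookup-∪⁅x⁆-y I (j≢x ∘ ≡.sym)) x∉I)) (∧-zeroʳ _))))

    guard-holds : addable I x ∧ lookup (I ∪ ⁅ x ⁆) x ≡ true
    guard-holds = cong₂ _∧_ (∉⇒addable I x x∉I 1≤mx) (lookup-∪⁅x⁆-x I x)

  ⊖∂-isCycle : ∀ i α β → IsCycle i α → IsCycle i (α ⊖ ∂ β)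
  ⊖∂-isCycle zero    α β _        = lift tt
  ⊖∂-isCycle (suc i) α β ∂α≈0 J J∈basis = begin
    ∂ (α ⊖ ∂ β) J        ≈⟨ ∂-⊖ α (∂ β) J ⟩
    ∂ α J + - ∂ (∂ β) J  ≈⟨ +-cong (∂α≈0 J J∈basis) (-‿cong (∂∘∂≈0 β J)) ⟩
    0# + - 0#            ≈⟨ -‿inverseʳ 0# ⟩
    0#                   ∎

  ⊖⊖-cancel : ∀ α β I → (α ⊖ (α ⊖ β)) I ≈ β I
  ⊖⊖-cancel α β I = begin
    α I + - (α I + - β I)  ≈⟨ +-congˡ (⁻¹-anti-homo‿- (α I) (β I)) ⟩
    α I + (β I + - α I)    ≈⟨ +-assoc (α I) (β I) (- α I) ⟨
    α I + β I + - α I      ≈⟨ xyx⁻¹≈y (α I) (β I) ⟩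
    β I                    ∎

  ⊖∂e[x]∧≈0 : ∀ x α I → lookup I x ≡ false → 1 ≤ m x → (α ⊖ ∂ (e[ x ]∧ α)) I ≈ 0#
  ⊖∂e[x]∧≈0 x α I x∉I 1≤mx = trans (+-congˡ (-‿cong (∂-e[x]∧-∉ x α I x∉I 1≤mx))) (-‿inverseʳ (α I))

lemma5p3 : ∀ {c ℓ} (k : Field c ℓ) (n : ℕ) (𝔞 : MonomialIdeal n) (m : Monomial n) (i : ℕ) (α : Koszul.Chain k 𝔞 m) → Koszul.IsCycle k 𝔞 m i α → (x₀ : Fin n) → var x₀ ∣ᵐ m → Σ (Koszul.Chain k 𝔞 m) λ α' → Koszul.IsCycle k 𝔞 m i α' × Koszul.Homologous k 𝔞 m i α α' × (∀ (I : Subset n) → Koszul.Basis k 𝔞 m i I → x₀ ∉ I → Field._≈_ k (α' I) (Field.0# k))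
lemma5p3 k n 𝔞 m i α α-cycle x₀ x₀∣m =
  α ⊖ ∂ β ,
  ⊖∂-isCycle i α β α-cycle ,
  (β , λ I _ → ⊖⊖-cancel α (∂ β) I) ,
  λ I _ x₀∉I → ⊖∂e[x]∧≈0 x₀ α I (∉⇒lookup≡false x₀∉I) (var-∣ᵐ⇒1≤ x₀∣m)
  where
  open KoszulComplex k 𝔞 m

  β : Chain
  β = e[ x₀ ]∧ α
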